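{- Let $(\mathcal{W},\mathcal{P})$ be a stable regular decomposition of length $l\geq 3$ and attachedness $p$ of a $p$-connected graph $G$, and let $\lambda=\{\alpha: P_\alpha\text{ is non-trivial}\}$. Let $\mathcal{Q}$ be a foundational linkage for $\mathcal{W}$. If $\alpha\beta$ is an edge of $\Gamma(\mathcal{W},\mathcal{Q})$ with $\alpha\in\lambda$ or $\beta\in\lambda$, then $\alpha\beta$ is an edge of $\Gamma(\mathcal{W},\mathcal{P})$.
   Context: For $S\subseteq G$, an $S$-bridge is either an edge not in $S$ with both ends in $S$, or for a component $C$ of $G-S$ the subgraph of all edges with an end in $C$; its attachments are its vertices in $S$, and it attaches to $S'\subseteq S$ if it has an attachment in $S'$. For a linkage (set of disjoint paths) $\mathcal{Q}$, $\mathcal{Q}$-bridges are bridges of $\bigcup\mathcal{Q}$. For $\mathcal{W}=(W_0,\ldots,W_l)$ with $W_i\subseteq V(G)$: $\mathcal{W}$ is a slim decomposition if (L1) the bags cover $V(G)$ and each edge lies in some $G[W_i]$; (L2) $W_i\cap W_k\subseteq W_j$ for $i\le j\le k$; (L3) all adhesion sets $W_{i-1}\cap W_i$ have the same size $q$ (the adhesion); (L4) no bag contains another; (L5) there are $q$ disjoint $(W_0\cap W_1)$--$(W_{l-1}\cap W_l)$ paths. Such paths with an enumeration $P_1,\dots,P_q$ form a foundational linkage $\mathcal{P}$ (paths may be trivial); any other foundational linkage $\mathcal{Q}=\{Q_1,\dots,Q_q\}$ is enumerated so that $Q_\alpha$ and $P_\alpha$ start at the same vertex. The $\alpha$-vertex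 of an adhesion set is its unique vertex on $P_\alpha$. Inner bags are $W_1,\dots,W_{l-1}$, with left/right adhesion sets $W_{i-1}\cap W_i$ and $W_i\cap W_{i+1}$; $P_\alpha[W]$ is the subpath of $P_\alpha$ between the left and right $\alpha$-vertex of $W$, $\mathcal{P}[W]=\{P_\alpha[W]\}$. A linkage in $G[W]$ from the left to the right adhesion set of an inner bag $W$ is enumerated by letting $Q_\alpha$ start at the left $\alpha$-vertex; its induced permutation $\pi$ has $Q_\alpha$ ending at the right $\pi(\alpha)$-vertex. $B(H,\mathcal{Q})$ is the graph on $\{1,\dots,q\}$ with $\alpha\beta$ an edge iff some $\mathcal{Q}$-bridge in $H$ attaches to $Q_\alpha$ and $Q_\beta$. For a foundational linkage $\mathcal{Q}$, $\Gamma(\mathcal{W},\mathcal{Q})=B(G[W_1\cup\dots\cup W_{l-1}],\mathcal{Q}$ restricted to this subgraph$)$. A linkage $\mathcal{Q}$ in $H$ is $p$-attached if its paths are induced in $H$ and each non-trivial $\mathcal{Q}$-bridge in $H$ attaching to a non-trivial path $P$ either attaches to another non-trivial path or there are $\ge p-2$ trivial paths $Q\in\mathcal{Q}$ such that some $\mathcal{Q}$-bridge in $H$ attaches to $P$ and $Q$. $(\mathcal{W},\mathcal{P})$ is a regular decomposition of attachedness $p$ if (L6) $\mathcal{P}[W]$ is $p$-attached in $G[W]$ for each inner bag $W$; (L7) $P_\alpha$ is trivial whenever $P_\alpha[W]$ is trivial for some inner bag $W$; (L8) if some inner bag $W$ has a $\mathcal{P}[W]$-bridge in $G[W]$ attaching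 to $P_\alpha$ and $P_\beta$, then every inner bag has one. It is stable if for every inner bag $W$ and every linkage $\mathcal{Q}$ in $G[W]$ from the left to the right adhesion set of $W$: (L10) the induced permutation of $\mathcal{Q}$ is an automorphism of $\Gamma(\mathcal{W},\mathcal{P})$; (L11) every edge of $B(G[W],\mathcal{Q})$ with an end in $\lambda$ is an edge of $\Gamma(\mathcal{W},\mathcal{P})$. -}

module Defs where

open import Level using (Level)
open import Data.Nat using (ℕ; zero; suc; _≤_; _<_; _∸_)
open import Data.Fin using (Fin)
open import Data.Fin.Subset using (Subset; _∩_; _⊆_; ∣_∣) renaming (_∈_ to _∈ₛ_; _∉_ to _∉ₛ_)
open import Data.List using (List; []; _∷_; _++_)
open import Data.List.Membership.Propositional using () renaming (_∈_ to _∈ₗ_)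
open import Data.List.Relation.Unary.All using (All)
open import Data.List.Relation.Unary.Unique.Propositional using (Unique)
open import Data.List.Relation.Unary.Linked using (Linked)
open import Data.Product using (Σ; ∃; ∃₂; _×_; _,_)
open import Data.Sum using (_⊎_)
open import Data.Empty using (⊥)
open import Data.Unit using (⊤)
open import Relation.Nullary using (¬_)
open import Relation.Binary.PropositionalEquality using (_≡_; _≢_)
open import Relation.Binary.Construct.Closure.ReflexiveTransitive using (Star)
open import Function.Bundles using (_⇔_)

record Graph : Set₁ where
  field
    n     : ℕ
    E     : Fin n → Fin n → Set
    E-sym : ∀ {u v} → E u v → E v u
    E-irr : ∀ {u} → ¬ E u u

lastOf : {A : Set} → A → List A → A
lastOf x []       = x
lastOf _ (y ∷ ys) = lastOf y ys

module _ (G : Graph) where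
  open Graph G

  Vtx : Set
  Vtx = Fin n

  -- Subgraphs (vertex predicate + edge predicate; an edge uv is present
  -- if es u v or es v u)

  record Subgraph : Set₁ where
    field
      vs : Vtx → Set
      es : Vtx → Vtx → Set

  open Subgraph

  HasEdge : Subgraph → Vtx → Vtx → Set
  HasEdge S u v = Subgraph.es S u v ⊎ Subgraph.es S v u

  induced : (Vtx → Set) → Subgraph
  induced X = record { vs = X ; es = λ u v → X u × X v × E u v }

  InSet : Subset n → Vtx → Set
  InSet X x = x ∈ₛ X

  ⋃ : ∀ {q} → (Fin q → Subgraph) → Subgraph
  ⋃ Q = record { vs = λ v → ∃ λ α → Subgraph.vs (Q α) v
               ; es = λ u v → ∃ λ α → Subgraph.es (Q α) u v }

  restrict : (Vtx → Set) → Subgraph → Subgraph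
  restrict X S = record { vs = λ v → Subgraph.vs S v × X v
                        ; es = λ u v → Subgraph.es S u v × X u × X v }

  TrivialSG : Subgraph → Set
  TrivialSG S = ∃ λ x → Subgraph.vs S x × (∀ v → Subgraph.vs S v → v ≡ x)

  record IsComponent (H S : Subgraph) (C : Vtx → Set) : Set where
    field
      inH       : ∀ {x} → C x → Subgraph.vs H x
      notS      : ∀ {x} → C x → ¬ Subgraph.vs S x
      inhabited : ∃ C
      connected : ∀ {x y} → C x → C y → Star (λ a b → C a × C b × HasEdge H a b) x y
      closed    : ∀ {x y} → C x → Subgraph.vs H y → ¬ Subgraph.vs S y → HasEdge H x y → C y

  -- an S-bridge in H: either an edge of H not in S with both ends in S
  -- (trivial bridge), or (the edges at) a component C of H - V(S)
  data Bridge (H S : Subgraph) : Set₁ where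
    edgeBridge : (u v : Vtx) → HasEdge H u v → ¬ HasEdge S u v →
                 Subgraph.vs S u → Subgraph.vs S v → Bridge H S
    compBridge : (C : Vtx → Set) → IsComponent H S C → Bridge H S

  NontrivialBridge : ∀ {H S} → Bridge H S → Set
  NontrivialBridge (edgeBridge _ _ _ _ _ _) = ⊥
  NontrivialBridge (compBridge _ _)         = ⊤

  Attachment : ∀ {H S} → Bridge H S → Vtx → Set
  Attachment (edgeBridge u v _ _ _ _) x = x ≡ u ⊎ x ≡ v
  Attachment {H} {S} (compBridge C _) x =
    Subgraph.vs S x × ∃ λ y → C y × HasEdge H y x

  AttachesTo : ∀ {H S} → Bridge H S → Subgraph → Set
  AttachesTo b T = ∃ λ x → Subgraph.vs T x × Attachment b x

  BEdge : ∀ {q} → Subgraph → (Fin q → Subgraph) → Fin q → Fin q → Set₁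
  BEdge H Q α β =
    α ≢ β × Σ (Bridge H (⋃ Q)) λ b → AttachesTo b (Q α) × AttachesTo b (Q β)

  record Path : Set where
    field
      first  : Vtx
      rest   : List Vtx
      unique : Unique (first ∷ rest)
      linked : Linked E (first ∷ rest)

  verts : Path → List Vtx
  verts P = Path.first P ∷ Path.rest P

  start : Path → Vtx
  start P = Path.first P

  end : Path → Vtx
  end P = lastOf (Path.first P) (Path.rest P)

  TrivialPath : Path → Set
  TrivialPath P = Path.rest P ≡ []

  Consec : Vtx → Vtx → List Vtx → Set
  Consec u v xs = ∃₂ λ as bs → xs ≡ as ++ (u ∷ v ∷ bs)

  pathSG : Path → Subgraph
  pathSG P = record { vs = λ v → v ∈ₗ verts P ; es = λ u v → Consec u v (verts P) }

  PathIn : Subgraph → Path → Set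
  PathIn H P = All (Subgraph.vs H) (verts P) ×
               (∀ u v → Consec u v (verts P) → HasEdge H u v)

  IsABPath : (Vtx → Set) → (Vtx → Set) → Path → Set
  IsABPath A B P = A (start P) × B (end P) ×
                   (∀ v → v ∈ₗ verts P → A v → v ≡ start P) ×
                   (∀ v → v ∈ₗ verts P → B v → v ≡ end P)

  Disjoint : ∀ {q} → (Fin q → Path) → Set
  Disjoint Q = ∀ α β → α ≢ β → ∀ v → v ∈ₗ verts (Q α) → ¬ (v ∈ₗ verts (Q β))

  Ends : List Vtx → Vtx → Vtx → Set
  Ends []      x y = ⊥
  Ends (a ∷ r) x y = (a ≡ x × lastOf a r ≡ y) ⊎ (a ≡ y × lastOf a r ≡ x)

  SegOcc : Path → Vtx → Vtx → List Vtx → Set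
  SegOcc P x y seg = ∃₂ λ as bs → verts P ≡ as ++ seg ++ bs × Ends seg x y

  segment : Path → Vtx → Vtx → Subgraph
  segment P x y = record
    { vs = λ v → ∃ λ seg → SegOcc P x y seg × v ∈ₗ seg
    ; es = λ u v → ∃ λ seg → SegOcc P x y seg × Consec u v seg }

  PConnected : ℕ → Set
  PConnected p = p < n ×
    (∀ (X : Subset n) → ∣ X ∣ < p → ∀ u v → u ∉ₛ X → v ∉ₛ X →
       Star (λ a b → a ∉ₛ X × b ∉ₛ X × E a b) u v)

  -- Decompositions W = (W 0, ..., W l); values W i for i > l are ignored.

  Adh : (ℕ → Subset n) → ℕ → Subset n
  Adh W i = W i ∩ W (suc i)

  -- W i is an inner bag (1 ≤ i ≤ l-1); left adhesion Adh W (i ∸ 1),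
  -- right adhesion Adh W i
  Inner : ℕ → ℕ → Set
  Inner l i = 1 ≤ i × suc i ≤ l

  InnerUnion : ℕ → (ℕ → Subset n) → Vtx → Set
  InnerUnion l W x = ∃ λ i → Inner l i × x ∈ₛ W i

  IsFoundational : (l q : ℕ) → (ℕ → Subset n) → (Fin q → Path) → Set
  IsFoundational l q W Q =
    Disjoint Q × (∀ α → IsABPath (InSet (Adh W 0)) (InSet (Adh W (l ∸ 1))) (Q α))

  record IsSlim (l q : ℕ) (W : ℕ → Subset n) : Set where
    field
      L1v : ∀ v → ∃ λ i → i ≤ l × v ∈ₛ W i
      L1e : ∀ u v → E u v → ∃ λ i → i ≤ l × u ∈ₛ W i × v ∈ₛ W i
      L2  : ∀ {i j k} → i ≤ j → j ≤ k → k ≤ l → (W i ∩ W k) ⊆ W j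
      L3  : ∀ i → suc i ≤ l → ∣ Adh W i ∣ ≡ q
      L4  : ∀ {i j} → i ≤ l → j ≤ l → i ≢ j → ¬ (W i ⊆ W j)
      L5  : Σ (Fin q → Path) (IsFoundational l q W)

  AlphaVtx : ∀ {q} → (Fin q → Path) → (ℕ → Subset n) → ℕ → Fin q → Vtx → Set
  AlphaVtx P W j α x = x ∈ₛ Adh W j × x ∈ₗ verts (P α)

  PW : ∀ {q} → (Fin q → Path) → (ℕ → Subset n) → ℕ → Fin q → Subgraph
  PW P W i α = record
    { vs = λ v → ∃₂ λ x y → AlphaVtx P W (i ∸ 1) α x × AlphaVtx P W i α y ×
                             Subgraph.vs (segment (P α) x y) v
    ; es = λ u v → ∃₂ λ x y → AlphaVtx P W (i ∸ 1) α x × AlphaVtx P W i α y ×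
                               Subgraph.es (segment (P α) x y) u v }

  Γ : ∀ {q} → ℕ → (ℕ → Subset n) → (Fin q → Path) → Fin q → Fin q → Set₁
  Γ l W Q α β = BEdge (induced (InnerUnion l W))
                      (λ γ → restrict (InnerUnion l W) (pathSG (Q γ))) α β

  record PAttached (p : ℕ) {q : ℕ} (H : Subgraph) (Q : Fin q → Subgraph) : Set₁ where
    field
      inducedPaths : ∀ α {u v} → Subgraph.vs (Q α) u → Subgraph.vs (Q α) v →
                     HasEdge H u v → HasEdge (Q α) u v
      bridgeCond : ∀ (b : Bridge H (⋃ Q)) → NontrivialBridge b →
        ∀ α → ¬ TrivialSG (Q α) → AttachesTo b (Q α) →
          (∃ λ β → β ≢ α × ¬ TrivialSG (Q β) × AttachesTo b (Q β))
          ⊎ (Σ (Subset q) λ T → p ∸ 2 ≤ ∣ T ∣ ×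
               (∀ β → β ∈ₛ T → TrivialSG (Q β) ×
                  Σ (Bridge H (⋃ Q)) λ b' → AttachesTo b' (Q α) × AttachesTo b' (Q β)))

  record IsRegular (p l q : ℕ) (W : ℕ → Subset n) (P : Fin q → Path) : Set₁ where
    field
      slim         : IsSlim l q W
      foundational : IsFoundational l q W P
      L6 : ∀ i → Inner l i → PAttached p (induced (InSet (W i))) (PW P W i)
      L7 : ∀ α → (∃ λ i → Inner l i × TrivialSG (PW P W i α)) → TrivialPath (P α)
      L8 : ∀ α β → (∃ λ i → Inner l i × BEdge (induced (InSet (W i))) (PW P W i) α β) →
           ∀ j → Inner l j → BEdge (induced (InSet (W j))) (PW P W j) α β

  -- Q is a linkage in G[W_i] from the left to the right adhesion set of W_i,
  -- enumerated so that Q α starts at the left α-vertex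
  InnerLinkage : ∀ {q} → (ℕ → Subset n) → (Fin q → Path) → ℕ → (Fin q → Path) → Set
  InnerLinkage W P i Q =
    Disjoint Q ×
    (∀ α → PathIn (induced (InSet (W i))) (Q α) ×
           IsABPath (InSet (Adh W (i ∸ 1))) (InSet (Adh W i)) (Q α) ×
           AlphaVtx P W (i ∸ 1) α (start (Q α)))

  record IsStable (l q : ℕ) (W : ℕ → Subset n) (P : Fin q → Path) : Set₁ where
    field
      -- the induced permutation π (Q α ends at the right π(α)-vertex)
      -- is an automorphism of Γ(W,P)
      L10 : ∀ i → Inner l i → (Q : Fin q → Path) → InnerLinkage W P i Q →
            (π : Fin q → Fin q) → (∀ α → AlphaVtx P W i (π α) (end (Q α))) →
            ∀ α β → (Γ l W P α β ⇔ Γ l W P (π α) (π β))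
      L11 : ∀ i → Inner l i → (Q : Fin q → Path) → InnerLinkage W P i Q →
            ∀ α β → BEdge (induced (InSet (W i))) (λ γ → pathSG (Q γ)) α β →
            (¬ TrivialPath (P α) ⊎ ¬ TrivialPath (P β)) → Γ l W P α β

-- Each path of a foundational linkage runs from W 0 to W l, so it meets every adhesion set;
-- as the q paths are disjoint and the adhesion sets have size q, it meets each of them exactly
-- once, and between its vertices in the two adhesion sets of an inner bag it stays inside that
-- bag. Hence the pieces of Q inside an inner bag form a linkage of the bag from its left to its
-- right adhesion set. Indexing paths by their vertex in Adh j gives bijections σ j between the
-- enumerations of Q and P: σ 0 is the identity because Q and P start together, and σ (j + 1) is
-- the permutation induced by the linkage of bag W (j + 1) composed with σ j, so by (L10) every
-- σ j preserves Γ(W,P). A Q-bridge of the inner part avoids the adhesion vertices (they all lie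
-- on Q), so it lives in a single inner bag and is a bridge of the bag linkage there; (L11) makes
-- σ α σ β an edge of Γ(W,P), and pulling back along σ gives αβ.

module Submission where

open import Defs
open import Data.Nat using (ℕ; zero; suc; _≤_; _<_; _∸_; z≤n; s≤s; _≤?_)
open import Data.Nat.Properties
  using (≤-refl; ≤-trans; ≤-pred; ≤-antisym; <⇒≤; ≰⇒>; <-irrefl; n≤1+n; m≤n⇒m≤1+n)
open import Data.Fin using (Fin; zero; suc)
open import Data.Fin.Properties using (any?; 0≢1+n; suc-injective) renaming (_≟_ to _≟ᶠ_)
open import Data.Fin.Subset using (Subset; ∣_∣; _-_; _∩_) renaming (_∈_ to _∈ₛ_; _∉_ to _∉ₛ_)
open import Data.Fin.Subset.Properties
  using (x∈p∧x≢y⇒x∈p-y; x∈p⇒∣p-x∣<∣p∣; x∈p∩q⁺; x∈p∩q⁻; _∈?_)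
open import Data.List using (List; []; _∷_; _++_; [_])
open import Data.List.Properties using (++-assoc)
open import Data.List.Membership.Propositional using (_∈_; _∉_)
open import Data.List.Membership.Propositional.Properties using (∈-++⁺ˡ; ∈-++⁺ʳ; ∈-++⁻; ∈-∃++)
open import Data.List.Relation.Unary.Any using (here; there)
open import Data.List.Relation.Unary.All using (All; []; _∷_; lookup; tabulate)
import Data.List.Relation.Unary.All.Properties as All
open import Data.List.Relation.Unary.AllPairs using ([]; _∷_)
open import Data.List.Relation.Unary.Linked using (Linked; []; [-]; _∷_)
open import Data.List.Relation.Unary.Unique.Propositional using (Unique)
open import Data.Product using (Σ; ∃; ∃₂; _×_; _,_; proj₁; proj₂)
open import Data.Sum using (_⊎_; inj₁; inj₂)
import Data.Sum as Sum
open import Data.Empty using (⊥-elim)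
open import Function using (_∘_)
open import Function.Bundles using (Equivalence)
open import Function.Definitions using (Injective)
open import Relation.Nullary using (¬_; yes; no)
open import Relation.Binary.Construct.Closure.ReflexiveTransitive using (Star; ε; _◅_)
import Relation.Binary.Construct.Closure.ReflexiveTransitive as Star
open import Relation.Binary.PropositionalEquality using (_≡_; _≢_; refl; sym; trans; cong; subst; subst₂)

injection⇒≤∣∣ : ∀ {m n} (X : Subset n) (f : Fin m → Fin n) →
                Injective _≡_ _≡_ f → (∀ i → f i ∈ₛ X) → m ≤ ∣ X ∣
injection⇒≤∣∣ {zero}  X f f-inj f∈X = z≤n
injection⇒≤∣∣ {suc m} X f f-inj f∈X =
  ≤-trans (s≤s (injection⇒≤∣∣ (X - f zero) (f ∘ suc) (suc-injective ∘ f-inj) f∘suc∈X-f0))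
          (x∈p⇒∣p-x∣<∣p∣ (f∈X zero))
  where
  f∘suc∈X-f0 : ∀ i → f (suc i) ∈ₛ X - f zero
  f∘suc∈X-f0 i = x∈p∧x≢y⇒x∈p-y (f∈X (suc i)) (λ eq → 0≢1+n (sym (f-inj eq)))

injection-onto-subset-of-its-size : ∀ {m n} (X : Subset n) (f : Fin m → Fin n) →
  Injective _≡_ _≡_ f → (∀ i → f i ∈ₛ X) → ∣ X ∣ ≡ m → ∀ {x} → x ∈ₛ X → ∃ λ i → f i ≡ x
injection-onto-subset-of-its-size {m} X f f-inj f∈X ∣X∣≡m {x} x∈X with any? (λ i → f i ≟ᶠ x)
... | yes hit = hit
... | no miss = ⊥-elim (<-irrefl (sym ∣X∣≡m) (≤-trans (s≤s m≤∣X-x∣) (x∈p⇒∣p-x∣<∣p∣ x∈X)))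
  where
  m≤∣X-x∣ : m ≤ ∣ X - x ∣
  m≤∣X-x∣ = injection⇒≤∣∣ (X - x) f f-inj (λ i → x∈p∧x≢y⇒x∈p-y (f∈X i) (λ eq → miss (i , eq)))

module _ {A : Set} where

  Unique-++⁻ˡ : ∀ (xs : List A) {ys} → Unique (xs ++ ys) → Unique xs
  Unique-++⁻ˡ []       _            = []
  Unique-++⁻ˡ (x ∷ xs) (x∉ ∷ uniq) = All.++⁻ˡ xs x∉ ∷ Unique-++⁻ˡ xs uniq

  Unique-++⁻ʳ : ∀ (xs : List A) {ys} → Unique (xs ++ ys) → Unique ys
  Unique-++⁻ʳ []       uniq       = uniq
  Unique-++⁻ʳ (x ∷ xs) (_ ∷ uniq) = Unique-++⁻ʳ xs uniq

  Unique-middle⇒∉-suffix : ∀ (xs : List A) {x ys} → Unique (xs ++ x ∷ ys) → x ∉ ys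
  Unique-middle⇒∉-suffix xs uniq x∈ys with Unique-++⁻ʳ xs uniq
  ... | x∉ ∷ _ = lookup x∉ x∈ys refl

  module _ {R : A → A → Set} where

    Linked-++⁻ˡ : ∀ (xs : List A) {ys} → Linked R (xs ++ ys) → Linked R xs
    Linked-++⁻ˡ []           _          = []
    Linked-++⁻ˡ (x ∷ [])     _          = [-]
    Linked-++⁻ˡ (x ∷ y ∷ xs) (r ∷ lnk) = r ∷ Linked-++⁻ˡ (y ∷ xs) lnk

    Linked-++⁻ʳ : ∀ (xs : List A) {ys} → Linked R (xs ++ ys) → Linked R ys
    Linked-++⁻ʳ []           lnk       = lnk
    Linked-++⁻ʳ (x ∷ [])     {[]}     _ = []
    Linked-++⁻ʳ (x ∷ [])     {y ∷ ys} (_ ∷ lnk) = lnk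
    Linked-++⁻ʳ (x ∷ y ∷ xs) (_ ∷ lnk) = Linked-++⁻ʳ (y ∷ xs) lnk

    Linked-consecutive : ∀ (xs : List A) {u v ys} → Linked R (xs ++ u ∷ v ∷ ys) → R u v
    Linked-consecutive []       (r ∷ _) = r
    Linked-consecutive (x ∷ xs) lnk     = Linked-consecutive xs (Linked-++⁻ʳ [ x ] lnk)

  lastOf-++ : ∀ (xs : List A) {u us x ys} → u ∷ us ≡ xs ++ x ∷ ys → lastOf u us ≡ lastOf x ys
  lastOf-++ []            refl = refl
  lastOf-++ (_ ∷ [])      {us = _ ∷ _} refl = refl
  lastOf-++ (_ ∷ x′ ∷ xs) {us = _ ∷ _} refl = lastOf-++ (x′ ∷ xs) refl

  prefix-through : ∀ (xs : List A) {u us x ys} → u ∷ us ≡ xs ++ x ∷ ys →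
                   ∃ λ r → u ∷ r ≡ xs ++ [ x ] × us ≡ r ++ ys
  prefix-through []       refl = [] , refl , refl
  prefix-through (_ ∷ xs) {x = x} {ys} refl = xs ++ [ x ] , refl , sym (++-assoc xs [ x ] ys)

  ∈-infix : ∀ (xs ys zs : List A) {v} → v ∈ ys → v ∈ xs ++ ys ++ zs
  ∈-infix xs ys zs v∈ys = ∈-++⁺ʳ xs (∈-++⁺ˡ v∈ys)

  consecutive-infix : ∀ (xs ys zs : List A) {u v} →
    (∃₂ λ as bs → ys ≡ as ++ u ∷ v ∷ bs) → ∃₂ λ as bs → xs ++ ys ++ zs ≡ as ++ u ∷ v ∷ bs
  consecutive-infix xs ys zs {u} {v} (as , bs , refl) = xs ++ as , bs ++ zs , reassoc
    where
    reassoc : xs ++ (as ++ u ∷ v ∷ bs) ++ zs ≡ (xs ++ as) ++ u ∷ v ∷ bs ++ zs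
    reassoc = trans (cong (xs ++_) (++-assoc as (u ∷ v ∷ bs) zs))
                    (sym (++-assoc xs as (u ∷ v ∷ bs ++ zs)))

  lastOf∈ : ∀ (x : A) xs → lastOf x xs ∈ x ∷ xs
  lastOf∈ x []       = here refl
  lastOf∈ x (y ∷ ys) = there (lastOf∈ y ys)

suc[n∸1]≡n : ∀ {m n} → m < n → suc (n ∸ 1) ≡ n
suc[n∸1]≡n (s≤s _) = refl


module PathProperties (G : Graph) where
  open Graph G

  subpath : (Q : Path G) (xs : List (Vtx G)) {x : Vtx G} {r zs : List (Vtx G)} →
            verts G Q ≡ xs ++ (x ∷ r) ++ zs → Path G
  subpath Q xs {x} {r} {zs} eq = record
    { first  = x
    ; rest   = r
    ; unique = Unique-++⁻ˡ (x ∷ r) (Unique-++⁻ʳ xs (subst Unique eq (Path.unique Q)))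
    ; linked = Linked-++⁻ˡ (x ∷ r) (Linked-++⁻ʳ xs (subst (Linked E) eq (Path.linked Q)))
    }

  module _ (Q : Path G) (xs : List (Vtx G)) {x r zs} (eq : verts G Q ≡ xs ++ (x ∷ r) ++ zs) where

    subpath-vertex : ∀ {v} → v ∈ verts G (subpath Q xs eq) → v ∈ verts G Q
    subpath-vertex {v} v∈ = subst (v ∈_) (sym eq) (∈-infix xs (x ∷ r) zs v∈)

    subpath-consecutive : ∀ {u v} → Consec G u v (verts G (subpath Q xs eq)) → Consec G u v (verts G Q)
    subpath-consecutive c with consecutive-infix xs (x ∷ r) zs c
    ... | as , bs , eq′ = as , bs , trans eq eq′

  hasEdge-induced : ∀ {X : Vtx G → Set} {u v} → HasEdge G (induced G X) u v → X u × X v × E u v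
  hasEdge-induced (inj₁ (u∈X , v∈X , e)) = u∈X , v∈X , e
  hasEdge-induced (inj₂ (v∈X , u∈X , e)) = u∈X , v∈X , E-sym e

  edge-of-induced : ∀ {X : Vtx G → Set} {u v} → HasEdge G (induced G X) u v → E u v
  edge-of-induced u~v = proj₂ (proj₂ (hasEdge-induced u~v))

  path-in-induced : ∀ {X : Vtx G → Set} (Q : Path G) → (∀ {v} → v ∈ verts G Q → X v) →
                    PathIn G (induced G X) Q
  path-in-induced Q ⊆X = tabulate ⊆X , edge
    where
    edge : ∀ u v → Consec G u v (verts G Q) → HasEdge G (induced G _) u v
    edge u v (as , bs , eq) =
      inj₁ ( ⊆X (subst (u ∈_) (sym eq) (∈-++⁺ʳ as (here refl)))
           , ⊆X (subst (v ∈_) (sym eq) (∈-++⁺ʳ as (there (here refl))))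
           , Linked-consecutive as (subst (Linked E) eq (Path.linked Q)) )

  shared-vertex⇒same-path : ∀ {q} (R : Fin q → Path G) → Disjoint G R →
    ∀ {α β v} → v ∈ verts G (R α) → v ∈ verts G (R β) → α ≡ β
  shared-vertex⇒same-path R disj {α} {β} {v} v∈α v∈β with α ≟ᶠ β
  ... | yes α≡β = α≡β
  ... | no  α≢β = ⊥-elim (disj α β α≢β v v∈α v∈β)

  trivial-path-vertex : ∀ (Q : Path G) {v} → TrivialPath G Q → v ∈ verts G Q → v ≡ start G Q
  trivial-path-vertex Q triv v∈ with Path.rest Q | triv | v∈
  ... | [] | refl | here v≡first = v≡first

module SlimDecomposition (G : Graph) {l q : ℕ} {W : ℕ → Subset (Graph.n G)} (slim : IsSlim G l q W) where
  open Graph G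
  open IsSlim slim

  LeftOf : ℕ → Vtx G → Set
  LeftOf j v = ∃ λ k → k ≤ j × v ∈ₛ W k

  RightOf : ℕ → Vtx G → Set
  RightOf j v = ∃ λ k → k ≤ l × j < k × v ∈ₛ W k

  left∧right⇒adhesion : ∀ {j v} → LeftOf j v → RightOf j v → v ∈ₛ Adh G W j
  left∧right⇒adhesion {v = v} (k , k≤j , v∈Wk) (k′ , k′≤l , j<k′ , v∈Wk′) =
    x∈p∩q⁺ (L2 k≤j (<⇒≤ j<k′) k′≤l v∈Wk∩Wk′ , L2 (m≤n⇒m≤1+n k≤j) j<k′ k′≤l v∈Wk∩Wk′)
    where
    v∈Wk∩Wk′ : v ∈ₛ W k ∩ W k′
    v∈Wk∩Wk′ = x∈p∩q⁺ (v∈Wk , v∈Wk′)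

  right∧left⇒bag : ∀ {i v} → RightOf i v → LeftOf (suc i) v → v ∈ₛ W (suc i)
  right∧left⇒bag (k′ , k′≤l , i<k′ , v∈Wk′) (k , k≤1+i , v∈Wk) =
    L2 k≤1+i i<k′ k′≤l (x∈p∩q⁺ (v∈Wk , v∈Wk′))

  ¬right⇒left : ∀ {j v} → ¬ RightOf j v → LeftOf j v
  ¬right⇒left {j} {v} ¬right with L1v v
  ... | k , k≤l , v∈Wk with suc j ≤? k
  ...   | yes j<k = ⊥-elim (¬right (k , k≤l , j<k , v∈Wk))
  ...   | no  j≮k = k , ≤-pred (≰⇒> j≮k) , v∈Wk

  ¬left⇒right : ∀ {j v} → ¬ LeftOf j v → RightOf j v
  ¬left⇒right {j} {v} ¬left with L1v v
  ... | k , k≤l , v∈Wk with k ≤? j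
  ...   | yes k≤j = ⊥-elim (¬left (k , k≤j , v∈Wk))
  ...   | no  k≰j = k , k≤l , ≰⇒> k≰j , v∈Wk

  edge-stays-left : ∀ {j u w} → LeftOf j u → u ∉ₛ Adh G W j → E u w → LeftOf j w
  edge-stays-left {j} {u} {w} left u∉Adh e with L1e u w e
  ... | m , m≤l , u∈Wm , w∈Wm with suc j ≤? m
  ...   | yes j<m = ⊥-elim (u∉Adh (left∧right⇒adhesion left (m , m≤l , j<m , u∈Wm)))
  ...   | no  j≮m = m , ≤-pred (≰⇒> j≮m) , w∈Wm

  record Crossing (j : ℕ) (xs : List (Vtx G)) : Set where
    field
      before after     : List (Vtx G)
      vertex           : Vtx G
      split            : xs ≡ before ++ vertex ∷ after
      vertex∈adhesion  : vertex ∈ₛ Adh G W j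
      before-not-right : All (λ z → ¬ RightOf j z) before

    vertex∈list : vertex ∈ xs
    vertex∈list = subst (vertex ∈_) (sym split) (∈-++⁺ʳ before (here refl))

  -- Opaque: only the fields of a crossing are ever used, and unfolding the search makes
  -- unification very slow.
  opaque
    crossing : ∀ j {u us} → Linked E (u ∷ us) → LeftOf j u → RightOf j (lastOf u us) → Crossing j (u ∷ us)
    crossing j {u} {us} lnk left right with u ∈? Adh G W j
    ... | yes u∈Adh = record { before = [] ; after = us ; vertex = u ; split = refl
                             ; vertex∈adhesion = u∈Adh ; before-not-right = [] }
    crossing j {u} {[]}     lnk       left right | no u∉Adh = ⊥-elim (u∉Adh (left∧right⇒adhesion left right))
    crossing j {u} {w ∷ us} (e ∷ lnk) left right | no u∉Adh = record
      { before = u ∷ before ; after = after ; vertex = vertex ; split = cong (u ∷_) split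
      ; vertex∈adhesion = vertex∈adhesion
      ; before-not-right = (λ right-u → u∉Adh (left∧right⇒adhesion left right-u)) ∷ before-not-right }
      where open Crossing (crossing j lnk (edge-stays-left left u∉Adh e) right)

  bag-interior-edge : ∀ {i c d} → suc (suc i) ≤ l → c ∈ₛ W (suc i) →
    c ∉ₛ Adh G W i → c ∉ₛ Adh G W (suc i) → E c d → d ∈ₛ W (suc i)
  bag-interior-edge {i} {c} {d} inner c∈W c∉left c∉right e with L1e c d e
  ... | m , m≤l , c∈Wm , d∈Wm with suc i ≤? m | m ≤? suc i
  ...   | no  i≮m | _       = ⊥-elim (c∉left (left∧right⇒adhesion (m , ≤-pred (≰⇒> i≮m) , c∈Wm)
                                                                 (suc i , <⇒≤ inner , ≤-refl , c∈W)))
  ...   | yes _   | no  m≰i = ⊥-elim (c∉right (left∧right⇒adhesion (suc i , ≤-refl , c∈W)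
                                                                   (m , m≤l , ≰⇒> m≰i , c∈Wm)))
  ...   | yes i<m | yes m≤i with ≤-antisym m≤i i<m
  ...     | refl = d∈Wm

  edge-in-inner-bag : 2 ≤ l → ∀ {u v} → InnerUnion G l W u → InnerUnion G l W v → E u v →
                      ∃ λ i → suc (suc i) ≤ l × u ∈ₛ W (suc i) × v ∈ₛ W (suc i)
  edge-in-inner-bag 2≤l {u} {v} u-inner v-inner e with L1e u v e
  ... | zero , _ , u∈W0 , v∈W0 = 0 , 2≤l , into-first u-inner u∈W0 , into-first v-inner v∈W0
    where
    into-first : ∀ {w} → InnerUnion G l W w → w ∈ₛ W 0 → w ∈ₛ W 1
    into-first (a , (1≤a , a<l) , w∈Wa) w∈W0 = L2 z≤n 1≤a (<⇒≤ a<l) (x∈p∩q⁺ (w∈W0 , w∈Wa))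
  ... | suc m , 1+m≤l , u∈Wm , v∈Wm with suc (suc m) ≤? l
  ...   | yes inner = m , inner , u∈Wm , v∈Wm
  ...   | no  outer = into-last-inner-bag m 1+m≤l (≤-pred (≰⇒> outer)) u∈Wm v∈Wm
    where
    into-last-inner-bag : ∀ m → suc m ≤ l → l ≤ suc m → u ∈ₛ W (suc m) → v ∈ₛ W (suc m) →
                          ∃ λ i → suc (suc i) ≤ l × u ∈ₛ W (suc i) × v ∈ₛ W (suc i)
    into-last-inner-bag zero    _      l≤1   _   _   = ⊥-elim (<-irrefl refl (≤-trans 2≤l l≤1))
    into-last-inner-bag (suc m) 2+m≤l l≤2+m u∈W v∈W = m , 2+m≤l , into-last u-inner u∈W , into-last v-inner v∈W
      where
      into-last : ∀ {w} → InnerUnion G l W w → w ∈ₛ W (suc (suc m)) → w ∈ₛ W (suc m)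
      into-last (a , (_ , a<l) , w∈Wa) w∈W =
        L2 (≤-pred (≤-trans a<l l≤2+m)) (n≤1+n _) 2+m≤l (x∈p∩q⁺ (w∈Wa , w∈W))

  module Foundational (R : Fin q → Path G) (R-found : IsFoundational G l q W R) where
    open PathProperties G

    R-disjoint : Disjoint G R
    R-disjoint = proj₁ R-found

    start-left : ∀ α j → LeftOf j (start G (R α))
    start-left α j = 0 , z≤n , proj₁ (x∈p∩q⁻ (W 0) (W 1) (proj₁ (proj₂ R-found α)))

    end-right : ∀ α {j} → j < l → RightOf j (end G (R α))
    end-right α j<l = l , ≤-refl , j<l ,
      subst (λ k → end G (R α) ∈ₛ W k) (suc[n∸1]≡n j<l)
            (proj₂ (x∈p∩q⁻ (W (l ∸ 1)) (W (suc (l ∸ 1))) (proj₁ (proj₂ (proj₂ R-found α)))))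

    suffix-walk : ∀ α xs {z zs} → verts G (R α) ≡ xs ++ z ∷ zs →
                  Linked E (z ∷ zs) × lastOf z zs ≡ end G (R α)
    suffix-walk α xs eq = Linked-++⁻ʳ xs (subst (Linked E) eq (Path.linked (R α))) ,
                          sym (lastOf-++ xs eq)

    crossingOf : ∀ {j} → j < l → ∀ α → Crossing j (verts G (R α))
    crossingOf {j} j<l α = crossing j (Path.linked (R α)) (start-left α j) (end-right α j<l)

    adhesion-vertex : ∀ {j} → j < l → Fin q → Vtx G
    adhesion-vertex j<l α = Crossing.vertex (crossingOf j<l α)

    adhesion-vertex∈path : ∀ {j} (j<l : j < l) α → adhesion-vertex j<l α ∈ verts G (R α)
    adhesion-vertex∈path j<l α = Crossing.vertex∈list (crossingOf j<l α)

    adhesion-vertex∈adhesion : ∀ {j} (j<l : j < l) α → adhesion-vertex j<l α ∈ₛ Adh G W j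
    adhesion-vertex∈adhesion j<l α = Crossing.vertex∈adhesion (crossingOf j<l α)

    -- The q disjoint paths meet Adh j in q distinct vertices, and ∣ Adh j ∣ ≡ q by (L3).
    opaque
      adhesion-vertex-onto : ∀ {j} (j<l : j < l) {x} → x ∈ₛ Adh G W j → ∃ λ α → adhesion-vertex j<l α ≡ x
      adhesion-vertex-onto {j} j<l =
        injection-onto-subset-of-its-size (Adh G W j) (adhesion-vertex j<l) injective
          (adhesion-vertex∈adhesion j<l) (L3 j j<l)
        where
        injective : ∀ {α β} → adhesion-vertex j<l α ≡ adhesion-vertex j<l β → α ≡ β
        injective {α} {β} eq = shared-vertex⇒same-path R R-disjoint (adhesion-vertex∈path j<l α)
                                 (subst (_∈ verts G (R β)) (sym eq) (adhesion-vertex∈path j<l β))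

    adhesion-covered : ∀ {j} → j < l → ∀ {x} → x ∈ₛ Adh G W j → ∃ λ α → x ∈ verts G (R α)
    adhesion-covered j<l x∈Adh with adhesion-vertex-onto j<l x∈Adh
    ... | α , refl = α , adhesion-vertex∈path j<l α

    path∩adhesion-unique : ∀ {j} (j<l : j < l) α {x} → x ∈ verts G (R α) → x ∈ₛ Adh G W j →
                           x ≡ adhesion-vertex j<l α
    path∩adhesion-unique j<l α x∈Rα x∈Adh with adhesion-vertex-onto j<l x∈Adh
    ... | β , refl with shared-vertex⇒same-path R R-disjoint x∈Rα (adhesion-vertex∈path j<l β)
    ...   | refl = refl

    path∩adhesion-unique₂ : ∀ {j} → j < l → ∀ α {x y} → x ∈ verts G (R α) → x ∈ₛ Adh G W j →
                            y ∈ verts G (R α) → y ∈ₛ Adh G W j → x ≡ y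
    path∩adhesion-unique₂ j<l α x∈Rα x∈Adh y∈Rα y∈Adh =
      trans (path∩adhesion-unique j<l α x∈Rα x∈Adh) (sym (path∩adhesion-unique j<l α y∈Rα y∈Adh))

    -- Otherwise the rest of the path would cross Adh j a second time.
    after-adhesion-not-left : ∀ {j} → j < l → ∀ α xs {x ys z} → verts G (R α) ≡ xs ++ x ∷ ys →
                              x ∈ₛ Adh G W j → z ∈ ys → ¬ LeftOf j z
    after-adhesion-not-left {j} j<l α xs {x} {z = z} eq x∈Adh z∈ys z-left with ∈-∃++ z∈ys
    ... | as , bs , refl = Unique-middle⇒∉-suffix xs (subst Unique eq (Path.unique (R α))) x∈ys
      where
      eq′ : verts G (R α) ≡ (xs ++ x ∷ as) ++ z ∷ bs
      eq′ = trans eq (sym (++-assoc xs (x ∷ as) (z ∷ bs)))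
      walk : Linked E (z ∷ bs) × lastOf z bs ≡ end G (R α)
      walk = suffix-walk α (xs ++ x ∷ as) eq′
      open Crossing (crossing j (proj₁ walk) z-left (subst (RightOf j) (sym (proj₂ walk)) (end-right α j<l)))
      vertex≡x : vertex ≡ x
      vertex≡x = path∩adhesion-unique₂ j<l α
        (subst (vertex ∈_) (sym eq′) (∈-++⁺ʳ (xs ++ x ∷ as) vertex∈list)) vertex∈adhesion
        (subst (x ∈_) (sym eq) (∈-++⁺ʳ xs (here refl))) x∈Adh
      x∈ys : x ∈ as ++ z ∷ bs
      x∈ys = ∈-++⁺ʳ as (subst (_∈ z ∷ bs) vertex≡x vertex∈list)

    module BagPath {i : ℕ} (inner : suc (suc i) ≤ l) (α : Fin q) where

      private
        open Crossing (crossingOf (<⇒≤ inner) α)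
          using () renaming (before to A; after to B; vertex to x; split to L≡AxB;
                             vertex∈adhesion to x∈Adh; before-not-right to A-not-right)

        x∈W : x ∈ₛ W (suc i)
        x∈W = proj₂ (x∈p∩q⁻ (W i) (W (suc i)) x∈Adh)

        walk : Linked E (x ∷ B) × lastOf x B ≡ end G (R α)
        walk = suffix-walk α A L≡AxB

        open Crossing (crossing (suc i) (proj₁ walk) (suc i , ≤-refl , x∈W)
                                (subst (RightOf (suc i)) (sym (proj₂ walk)) (end-right α inner)))
          using () renaming (before to C; after to D; vertex to y; split to xB≡CyD;
                             vertex∈adhesion to y∈Adh; before-not-right to C-not-right)

        y∈W : y ∈ₛ W (suc i)
        y∈W = proj₁ (x∈p∩q⁻ (W (suc i)) (W (suc (suc i))) y∈Adh)

        through : ∃ λ r → x ∷ r ≡ C ++ [ y ] × B ≡ r ++ D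
        through = prefix-through C xB≡CyD

        r : List (Vtx G)
        r = proj₁ through

        L≡A-xr-D : verts G (R α) ≡ A ++ (x ∷ r) ++ D
        L≡A-xr-D = trans L≡AxB (cong (λ t → A ++ x ∷ t) (proj₂ (proj₂ through)))

        L≡ACyD : verts G (R α) ≡ (A ++ C) ++ y ∷ D
        L≡ACyD = trans L≡AxB (trans (cong (A ++_) xB≡CyD) (sym (++-assoc A C (y ∷ D))))

        y∈path : y ∈ verts G (R α)
        y∈path = subst (y ∈_) (sym L≡ACyD) (∈-++⁺ʳ (A ++ C) (here refl))

      bagPath : Path G
      bagPath = subpath (R α) A {x} {r} {D} L≡A-xr-D

      bagPath-end : end G bagPath ≡ y
      bagPath-end = lastOf-++ C (proj₁ (proj₂ through))

      bagPath⊆path : ∀ {v} → v ∈ verts G bagPath → v ∈ verts G (R α)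
      bagPath⊆path = subpath-vertex (R α) A {x} {r} {D} L≡A-xr-D

      bagPath-consecutive⊆path : ∀ {u v} → Consec G u v (verts G bagPath) → Consec G u v (verts G (R α))
      bagPath-consecutive⊆path = subpath-consecutive (R α) A {x} {r} {D} L≡A-xr-D

      bagPath⊆bag : ∀ {z} → z ∈ verts G bagPath → z ∈ₛ W (suc i)
      bagPath⊆bag {z} z∈ with ∈-++⁻ C (subst (z ∈_) (proj₁ (proj₂ through)) z∈)
      ... | inj₂ (here refl) = y∈W
      ... | inj₁ z∈C with subst (z ∈_) (sym xB≡CyD) (∈-++⁺ˡ z∈C)
      ...   | here refl = x∈W
      ...   | there z∈B =
        right∧left⇒bag (¬left⇒right (after-adhesion-not-left (<⇒≤ inner) α A L≡AxB x∈Adh z∈B))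
                                         (¬right⇒left (lookup C-not-right z∈C))

      path∩bag⊆bagPath : ∀ {z} → z ∈ verts G (R α) → z ∈ₛ W (suc i) → z ∈ verts G bagPath
      path∩bag⊆bagPath {z} z∈ z∈W with ∈-++⁻ A (subst (z ∈_) L≡A-xr-D z∈)
      ... | inj₁ z∈A = ⊥-elim (lookup A-not-right z∈A (suc i , <⇒≤ inner , ≤-refl , z∈W))
      ... | inj₂ z∈xrD with ∈-++⁻ (x ∷ r) z∈xrD
      ...   | inj₁ z∈xr = z∈xr
      ...   | inj₂ z∈D = ⊥-elim (after-adhesion-not-left inner α (A ++ C) L≡ACyD y∈Adh z∈D
                                                         (suc i , ≤-refl , z∈W))

      bagPath-in-bag : PathIn G (induced G (InSet G (W (suc i)))) bagPath
      bagPath-in-bag = path-in-induced bagPath bagPath⊆bag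

      bagPath-between-adhesions : IsABPath G (InSet G (Adh G W i)) (InSet G (Adh G W (suc i))) bagPath
      bagPath-between-adhesions =
        x∈Adh , subst (InSet G (Adh G W (suc i))) (sym bagPath-end) y∈Adh ,
        (λ v v∈ v∈Adh → path∩adhesion-unique (<⇒≤ inner) α (bagPath⊆path v∈) v∈Adh) ,
        (λ v v∈ v∈Adh → trans (path∩adhesion-unique₂ inner α (bagPath⊆path v∈) v∈Adh y∈path y∈Adh)
                              (sym bagPath-end))

  -- reindex j<l α is the index of the R′-path through the vertex where R α meets Adh j.
  module Reindex (R R′ : Fin q → Path G)
                (R-found : IsFoundational G l q W R) (R′-found : IsFoundational G l q W R′) where
    private
      module F  = Foundational R  R-found
      module F′ = Foundational R′ R′-found

    opaque
      reindex : ∀ {j} → j < l → Fin q → Fin q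
      reindex j<l α = proj₁ (F′.adhesion-covered j<l (F.adhesion-vertex∈adhesion j<l α))

      adhesion-vertex∈reindex : ∀ {j} (j<l : j < l) α → F.adhesion-vertex j<l α ∈ verts G (R′ (reindex j<l α))
      adhesion-vertex∈reindex j<l α = proj₂ (F′.adhesion-covered j<l (F.adhesion-vertex∈adhesion j<l α))

    adhesion-vertex-reindex : ∀ {j} (j<l : j < l) α →
                              F′.adhesion-vertex j<l (reindex j<l α) ≡ F.adhesion-vertex j<l α
    adhesion-vertex-reindex j<l α =
      sym (F′.path∩adhesion-unique j<l (reindex j<l α) (adhesion-vertex∈reindex j<l α)
                                   (F.adhesion-vertex∈adhesion j<l α))

    path∩adhesion⊆reindex : ∀ {j} (j<l : j < l) α {x} → x ∈ verts G (R α) → x ∈ₛ Adh G W j →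
                           x ∈ verts G (R′ (reindex j<l α))
    path∩adhesion⊆reindex j<l α {x} x∈Rα x∈Adh =
      subst (_∈ verts G (R′ (reindex j<l α))) (sym (F.path∩adhesion-unique j<l α x∈Rα x∈Adh))
            (adhesion-vertex∈reindex j<l α)

    reindex-at-start : ∀ (0<l : 0 < l) → (∀ α → start G (R α) ≡ start G (R′ α)) →
                       ∀ α → reindex 0<l α ≡ α
    reindex-at-start 0<l same-start α =
      PathProperties.shared-vertex⇒same-path G R′ F′.R-disjoint
        (path∩adhesion⊆reindex 0<l α (here refl) (proj₁ (proj₂ R-found α)))
        (subst (_∈ verts G (R′ α)) (sym (same-start α)) (here refl))

    reindex-onto-trivial : ∀ {j} (j<l : j < l) → (∀ α → start G (R′ α) ≡ start G (R α)) →
                          ∀ α → TrivialPath G (R′ (reindex j<l α)) → reindex j<l α ≡ α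
    reindex-onto-trivial j<l same-start α triv =
      PathProperties.shared-vertex⇒same-path G R F.R-disjoint
        (subst (_∈ verts G (R (reindex j<l α))) (sym x≡start) (here refl))
        (F.adhesion-vertex∈path j<l α)
      where
      x≡start : F.adhesion-vertex j<l α ≡ start G (R (reindex j<l α))
      x≡start = trans (PathProperties.trivial-path-vertex G (R′ (reindex j<l α)) triv
                                                            (adhesion-vertex∈reindex j<l α))
                      (same-start (reindex j<l α))

  reindex-inverse : ∀ (R R′ : Fin q → Path G)
    (R-found : IsFoundational G l q W R) (R′-found : IsFoundational G l q W R′) → ∀ {j} (j<l : j < l) α →
    Reindex.reindex R′ R R′-found R-found j<l (Reindex.reindex R R′ R-found R′-found j<l α) ≡ α
  reindex-inverse R R′ R-found R′-found j<l α =
    PathProperties.shared-vertex⇒same-path G R (proj₁ R-found)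
      (Reindex.adhesion-vertex∈reindex R′ R R′-found R-found j<l β)
      (subst (_∈ verts G (R α)) (sym (Reindex.adhesion-vertex-reindex R R′ R-found R′-found j<l α))
             (Foundational.adhesion-vertex∈path R R-found j<l α))
    where
    β : Fin q
    β = Reindex.reindex R R′ R-found R′-found j<l α

module Relinking (G : Graph) {l q : ℕ} {W : ℕ → Subset (Graph.n G)} (slim : IsSlim G l q W)
                 (P Q : Fin q → Path G) (P-found : IsFoundational G l q W P) (Q-found : IsFoundational G l q W Q)
                 (same-start : ∀ α → start G (Q α) ≡ start G (P α)) where
  open Graph G
  open SlimDecomposition G slim
  open PathProperties G
  private
    module FQ = Foundational Q Q-found

  σ : ∀ {j} → j < l → Fin q → Fin q
  σ = Reindex.reindex Q P Q-found P-found

  τ : ∀ {j} → j < l → Fin q → Fin q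
  τ = Reindex.reindex P Q P-found Q-found

  τ∘σ : ∀ {j} (j<l : j < l) α → τ j<l (σ j<l α) ≡ α
  τ∘σ = reindex-inverse Q P Q-found P-found

  σ∘τ : ∀ {j} (j<l : j < l) γ → σ j<l (τ j<l γ) ≡ γ
  σ∘τ = reindex-inverse P Q P-found Q-found

  σ-at-start : ∀ (0<l : 0 < l) α → σ 0<l α ≡ α
  σ-at-start 0<l = Reindex.reindex-at-start Q P Q-found P-found 0<l same-start

  σ-nontrivial : ∀ {j} (j<l : j < l) α → ¬ TrivialPath G (P α) → ¬ TrivialPath G (P (σ j<l α))
  σ-nontrivial j<l α nontrivial trivial =
    nontrivial (subst (λ β → TrivialPath G (P β))
                      (Reindex.reindex-onto-trivial Q P Q-found P-found j<l (λ β → sym (same-start β)) α trivial)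
                      trivial)

  σ-injective : ∀ {j} (j<l : j < l) {α β} → σ j<l α ≡ σ j<l β → α ≡ β
  σ-injective j<l {α} {β} eq = trans (sym (τ∘σ j<l α)) (trans (cong (τ j<l) eq) (τ∘σ j<l β))

  Inner∪ : Vtx G → Set
  Inner∪ = InnerUnion G l W

  H : Subgraph G
  H = induced G Inner∪

  Q∩H : Fin q → Subgraph G
  Q∩H γ = restrict G Inner∪ (pathSG G (Q γ))

  S : Subgraph G
  S = ⋃ G Q∩H

  component-avoids-adhesion : ∀ {C} → IsComponent G H S C → ∀ {c j} → C c → j < l → c ∉ₛ Adh G W j
  component-avoids-adhesion comp c∈C j<l c∈Adh with FQ.adhesion-covered j<l c∈Adh
  ... | γ , c∈Qγ = IsComponent.notS comp c∈C (γ , c∈Qγ , IsComponent.inH comp c∈C)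

  component⊆bag : ∀ {C} → IsComponent G H S C → ∀ {i} → suc (suc i) ≤ l →
                  ∀ {c₀} → C c₀ → c₀ ∈ₛ W (suc i) → ∀ {c} → C c → c ∈ₛ W (suc i)
  component⊆bag {C} comp {i} inner c₀∈C c₀∈W c∈C =
    walk c₀∈C c₀∈W (IsComponent.connected comp c₀∈C c∈C)
    where
    walk : ∀ {a b} → C a → a ∈ₛ W (suc i) → Star (λ a b → C a × C b × HasEdge G H a b) a b →
           b ∈ₛ W (suc i)
    walk a∈C a∈W ε = a∈W
    walk a∈C a∈W ((_ , b∈C , a~b) ◅ walk-on) =
      walk b∈C (bag-interior-edge inner a∈W (component-avoids-adhesion comp a∈C (<⇒≤ inner))
                                            (component-avoids-adhesion comp a∈C inner)
                                            (edge-of-induced a~b))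
           walk-on

  module BagLinkage {i : ℕ} (inner : suc (suc i) ≤ l) where

    σ-left : Fin q → Fin q
    σ-left = σ (<⇒≤ inner)

    τ-left : Fin q → Fin q
    τ-left = τ (<⇒≤ inner)

    private
      module Bag γ = FQ.BagPath inner (τ-left γ)

    linkage : Fin q → Path G
    linkage γ = Bag.bagPath γ

    linkage⊆Q : ∀ γ {x} → x ∈ verts G (linkage γ) → x ∈ verts G (Q (τ-left γ))
    linkage⊆Q γ = Bag.bagPath⊆path γ

    linkage-consecutive⊆Q : ∀ γ {u v} → Consec G u v (verts G (linkage γ)) →
                            Consec G u v (verts G (Q (τ-left γ)))
    linkage-consecutive⊆Q γ = Bag.bagPath-consecutive⊆path γ

    Q∩bag⊆linkage : ∀ α {x} → x ∈ verts G (Q α) → x ∈ₛ W (suc i) → x ∈ verts G (linkage (σ-left α))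
    Q∩bag⊆linkage α {x} x∈Q x∈W =
      Bag.path∩bag⊆bagPath (σ-left α)
        (subst (λ β → x ∈ verts G (Q β)) (sym (τ∘σ (<⇒≤ inner) α)) x∈Q) x∈W

    linkage-inner : InnerLinkage G W P (suc i) linkage
    linkage-inner = disjoint , λ γ → Bag.bagPath-in-bag γ , Bag.bagPath-between-adhesions γ ,
                                     proj₁ (Bag.bagPath-between-adhesions γ) , start∈P γ
      where
      disjoint : Disjoint G linkage
      disjoint γ δ γ≢δ v v∈γ v∈δ =
        γ≢δ (trans (sym (σ∘τ (<⇒≤ inner) γ))
                   (trans (cong σ-left (shared-vertex⇒same-path Q FQ.R-disjoint
                                          (linkage⊆Q γ v∈γ) (linkage⊆Q δ v∈δ)))
                          (σ∘τ (<⇒≤ inner) δ)))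
      start∈P : ∀ γ → start G (linkage γ) ∈ verts G (P γ)
      start∈P γ = subst (λ β → start G (linkage γ) ∈ verts G (P β)) (σ∘τ (<⇒≤ inner) γ)
        (Reindex.path∩adhesion⊆reindex Q P Q-found P-found (<⇒≤ inner) (τ-left γ)
           (linkage⊆Q γ (here refl)) (proj₁ (Bag.bagPath-between-adhesions γ)))

    permutation : Fin q → Fin q
    permutation γ = σ inner (τ-left γ)

    linkage-ends : ∀ γ → AlphaVtx G P W (suc i) (permutation γ) (end G (linkage γ))
    linkage-ends γ = end∈Adh ,
      Reindex.path∩adhesion⊆reindex Q P Q-found P-found inner (τ-left γ)
        (linkage⊆Q γ (lastOf∈ _ (Path.rest (linkage γ)))) end∈Adh
      where
      end∈Adh : end G (linkage γ) ∈ₛ Adh G W (suc i)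
      end∈Adh = proj₁ (proj₂ (Bag.bagPath-between-adhesions γ))

    σ-step : ∀ α → σ inner α ≡ permutation (σ-left α)
    σ-step α = cong (σ inner) (sym (τ∘σ (<⇒≤ inner) α))

    bag⊆inner : ∀ {x} → x ∈ₛ W (suc i) → Inner∪ x
    bag⊆inner x∈W = suc i , (s≤s z≤n , inner) , x∈W

    Hᵢ : Subgraph G
    Hᵢ = induced G (InSet G (W (suc i)))

    Sᵢ : Subgraph G
    Sᵢ = ⋃ G (λ γ → pathSG G (linkage γ))

    S∩bag⊆Sᵢ : ∀ {x} → Subgraph.vs S x → x ∈ₛ W (suc i) → Subgraph.vs Sᵢ x
    S∩bag⊆Sᵢ (γ , x∈Qγ , _) x∈W = σ-left γ , Q∩bag⊆linkage γ x∈Qγ x∈W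

    Sᵢ⊆S : ∀ {x} → Inner∪ x → Subgraph.vs Sᵢ x → Subgraph.vs S x
    Sᵢ⊆S x∈∪ (γ , x∈γ) = τ-left γ , linkage⊆Q γ x∈γ , x∈∪

    Sᵢ-edge⇒S-edge : ∀ {u v} → Inner∪ u → Inner∪ v → HasEdge G Sᵢ u v → HasEdge G S u v
    Sᵢ-edge⇒S-edge u∈∪ v∈∪ (inj₁ (γ , u~v)) =
      inj₁ (τ-left γ , linkage-consecutive⊆Q γ u~v , u∈∪ , v∈∪)
    Sᵢ-edge⇒S-edge u∈∪ v∈∪ (inj₂ (γ , v~u)) =
      inj₂ (τ-left γ , linkage-consecutive⊆Q γ v~u , v∈∪ , u∈∪)

    localise-edge-bridge : ∀ {α β u v} → α ≢ β → E u v → u ∈ₛ W (suc i) → v ∈ₛ W (suc i) →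
      ¬ HasEdge G S u v → Subgraph.vs S u → Subgraph.vs S v →
      (∃ λ x → Subgraph.vs (Q∩H α) x × (x ≡ u ⊎ x ≡ v)) →
      (∃ λ x → Subgraph.vs (Q∩H β) x × (x ≡ u ⊎ x ≡ v)) →
      BEdge G Hᵢ (λ γ → pathSG G (linkage γ)) (σ-left α) (σ-left β)
    localise-edge-bridge {u = u} {v} α≢β e u∈W v∈W ¬u~v u∈S v∈S att-α att-β =
      α≢β ∘ σ-injective (<⇒≤ inner) ,
      edgeBridge u v (inj₁ (u∈W , v∈W , e)) (¬u~v ∘ Sᵢ-edge⇒S-edge (bag⊆inner u∈W) (bag⊆inner v∈W))
                 (S∩bag⊆Sᵢ u∈S u∈W) (S∩bag⊆Sᵢ v∈S v∈W) ,
      attach att-α , attach att-β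
      where
      attach : ∀ {γ} → (∃ λ x → Subgraph.vs (Q∩H γ) x × (x ≡ u ⊎ x ≡ v)) →
               ∃ λ x → x ∈ verts G (linkage (σ-left γ)) × (x ≡ u ⊎ x ≡ v)
      attach (x , (x∈Q , _) , inj₁ refl) = x , Q∩bag⊆linkage _ x∈Q u∈W , inj₁ refl
      attach (x , (x∈Q , _) , inj₂ refl) = x , Q∩bag⊆linkage _ x∈Q v∈W , inj₂ refl

    localise-component-bridge : ∀ {α β C} → α ≢ β → (comp : IsComponent G H S C) →
      (∀ {c} → C c → c ∈ₛ W (suc i)) → ∃ C →
      AttachesTo G (compBridge C comp) (Q∩H α) → AttachesTo G (compBridge C comp) (Q∩H β) →
      BEdge G Hᵢ (λ γ → pathSG G (linkage γ)) (σ-left α) (σ-left β)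
    localise-component-bridge {C = C} α≢β comp C⊆W C-inhabited att-α att-β =
      α≢β ∘ σ-injective (<⇒≤ inner) , compBridge C compᵢ , attach att-α , attach att-β
      where
      open IsComponent comp
      avoid : ∀ {c j} → C c → j < l → c ∉ₛ Adh G W j
      avoid = component-avoids-adhesion comp
      compᵢ : IsComponent G Hᵢ Sᵢ C
      compᵢ = record
        { inH       = C⊆W
        ; notS      = λ c∈C c∈Sᵢ → notS c∈C (Sᵢ⊆S (inH c∈C) c∈Sᵢ)
        ; inhabited = C-inhabited
        ; connected = λ x∈C y∈C → Star.map
            (λ { (a∈C , b∈C , a~b) → a∈C , b∈C , inj₁ (C⊆W a∈C , C⊆W b∈C , edge-of-induced a~b) })
            (connected x∈C y∈C)
        ; closed    = λ x∈C y∈W y∉Sᵢ x~y → closed x∈C (bag⊆inner y∈W) (λ y∈S → y∉Sᵢ (S∩bag⊆Sᵢ y∈S y∈W))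
                                            (inj₁ (inH x∈C , bag⊆inner y∈W , edge-of-induced x~y))
        }
      attach : ∀ {γ} → AttachesTo G (compBridge C comp) (Q∩H γ) →
               AttachesTo G (compBridge C compᵢ) (pathSG G (linkage (σ-left γ)))
      attach {γ} (x , (x∈Q , _) , _ , y , y∈C , y~x) =
        x , x∈R , (σ-left γ , x∈R) , y , y∈C , inj₁ (C⊆W y∈C , x∈W , e)
        where
        e : E y x
        e = edge-of-induced y~x
        x∈W : x ∈ₛ W (suc i)
        x∈W = bag-interior-edge inner (C⊆W y∈C) (avoid y∈C (<⇒≤ inner)) (avoid y∈C inner) e
        x∈R : x ∈ verts G (linkage (σ-left γ))
        x∈R = Q∩bag⊆linkage γ x∈Q x∈W

  open BagLinkage

  -- σ 0 is the identity and σ (suc i) is σ i followed by the permutation induced in the bag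
  -- W (suc i), which is an automorphism of Γ(W,P) by (L10).
  σ-reflects-Γ : IsStable G l q W P → ∀ {j} (j<l : j < l) {α β} →
            Γ G l W P (σ j<l α) (σ j<l β) → Γ G l W P α β
  σ-reflects-Γ stable {zero}  0<l   {α} {β} = subst₂ (Γ G l W P) (σ-at-start 0<l α) (σ-at-start 0<l β)
  σ-reflects-Γ stable {suc i} inner {α} {β} edge =
    σ-reflects-Γ stable (<⇒≤ inner)
      (Equivalence.from (IsStable.L10 stable (suc i) (s≤s z≤n , inner) (linkage inner) (linkage-inner inner)
                           (permutation inner) (linkage-ends inner) (σ-left inner α) (σ-left inner β))
        (subst₂ (Γ G l W P) (σ-step inner α) (σ-step inner β) edge))

  BagEdge : Fin q → Fin q → Set₁
  BagEdge α β = ∃ λ i → Σ (suc (suc i) ≤ l) λ inner →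
    BEdge G (Hᵢ inner) (λ γ → pathSG G (linkage inner γ)) (σ-left inner α) (σ-left inner β)

  Γ-edge-in-bag : 2 ≤ l → ∀ {α β} → Γ G l W Q α β → BagEdge α β
  Γ-edge-in-bag 2≤l (α≢β , edgeBridge u v u~v ¬u~v u∈S v∈S , att-α , att-β) =
    let (u∈∪ , v∈∪ , e) = hasEdge-induced u~v
        (i , inner , u∈W , v∈W) = edge-in-inner-bag 2≤l u∈∪ v∈∪ e
    in i , inner , localise-edge-bridge inner α≢β e u∈W v∈W ¬u~v u∈S v∈S att-α att-β
  Γ-edge-in-bag 2≤l {α} {β} (α≢β , compBridge C comp , att-α , att-β) = in-bag (IsComponent.inH comp c₀∈C)
    where
    c₀ : Vtx G
    c₀ = proj₁ (IsComponent.inhabited comp)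
    c₀∈C : C c₀
    c₀∈C = proj₂ (IsComponent.inhabited comp)
    in-bag : Inner∪ c₀ → BagEdge α β
    in-bag (zero  , (() , _) , _)
    in-bag (suc i , (_ , inner) , c₀∈W) =
      i , inner , localise-component-bridge inner α≢β comp (component⊆bag comp inner c₀∈C c₀∈W)
                    (IsComponent.inhabited comp) att-α att-β

  bag-edge⇒Γ : IsStable G l q W P → ∀ {α β} → BagEdge α β →
               (¬ TrivialPath G (P α) ⊎ ¬ TrivialPath G (P β)) → Γ G l W P α β
  bag-edge⇒Γ stable {α} {β} (i , inner , edge) nontrivial =
    σ-reflects-Γ stable (<⇒≤ inner)
      (IsStable.L11 stable (suc i) (s≤s z≤n , inner) (linkage inner) (linkage-inner inner) _ _ edge
        (Sum.map (σ-nontrivial (<⇒≤ inner) α) (σ-nontrivial (<⇒≤ inner) β) nontrivial))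

lemma20 : (G : Graph) (p l q : ℕ) (W : ℕ → Subset (Graph.n G)) (P Q : Fin q → Path G) →
    PConnected G p → 3 ≤ l → IsRegular G p l q W P → IsStable G l q W P →
    IsFoundational G l q W Q → (∀ α → start G (Q α) ≡ start G (P α)) →
    ∀ α β → Γ G l W Q α β → (¬ TrivialPath G (P α) ⊎ ¬ TrivialPath G (P β)) →
    Γ G l W P α β
lemma20 G p l q W P Q _ 3≤l regular stable Q-found same-start α β Γ-edge nontrivial =
  bag-edge⇒Γ stable (Γ-edge-in-bag (<⇒≤ 3≤l) Γ-edge) nontrivial
  where
  open Relinking G (IsRegular.slim regular) P Q (IsRegular.foundational regular) Q-found same-start
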